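{- Let $T\subseteq X_0$ be a generalised nice set and let $i,j\in I$ be distinct. Then: (i) $T\cap X$ is a nice set; (ii) if $\{i,0\}\in T$ then $\{0,0\}\in T$; (iii) if $\{i,i*j\},\{j,i*j\}\in T$ then $\{i*j,i*j\}\in T$; (iv) if $T\subseteq X$ then $T\cup\{\{0,0\}\}$ is a generalised nice set.
   Context: Let $I=\{1,\dots,7\}$ and $I_0=I\cup\{0\}$. The Fano plane on $I$ has the seven lines $\{1,2,5\},\{5,6,7\},\{1,4,7\},\{1,3,6\},\{2,4,6\},\{2,3,7\},\{3,4,5\}$. For distinct $i,j\in I$, $i*j$ is the third point of the unique line containing $i$ and $j$. The operation is extended to $I_0$ by $0*i=i*0=i$ and $i*i=0$ for all $i\in I_0$. Three pairwise distinct $i,j,k\in I$ are generative if $k\neq i*j$. Let $X_0$ be the set of unordered pairs $\{i,j\}$ with $i,j\in I_0$, where $i=j$ is allowed, and $X=\{\{i,j\}:i,j\in I,\ i\neq j\}$. For $i,j,k\in I_0$ let $P_{\{i,j,k\}}=\{\{i,j\},\{j,k\},\{k,i\},\{i,j*k\},\{j,k*i\},\{k,i*j\}\}\subseteq X_0$. A subset $T\subseteq X_0$ is a generalised nice set if for all $i,j,k\in I_0$, $\{i,j\}\in T$ and $\{i*j,k\}\in T$ imply $P_{\{i,j,k\}}\subseteq T$. A subset $T\subseteq X$ is nice if whenever $\{i,j\},\{i*j,k\}\in T$ for some generative $i,j,k\in I$, then $P_{\{i,j,k\}}\subseteq T$. -}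

module Defs where

open import Data.Fin using (Fin; zero; suc; toℕ)
open import Data.Nat using (ℕ; _≤_; _≤?_)
import Data.Nat
import Data.Nat.Properties
import Relation.Nullary
open import Data.Product using (_×_; _,_; Σ)
open import Relation.Nullary using (¬_)
open import Relation.Binary.PropositionalEquality using (_≡_)
open import Level using (0ℓ)
open import Relation.Unary using (Pred; _⊆_)

-- I₀ = {0,1,…,7} is modelled as Fin 8; the point 0 is `zero`, I = nonzero points.
Pt : Set
Pt = Fin 8

pattern p0 = zero
pattern p1 = suc zero
pattern p2 = suc (suc zero)
pattern p3 = suc (suc (suc zero))
pattern p4 = suc (suc (suc (suc zero)))
pattern p5 = suc (suc (suc (suc (suc zero))))
pattern p6 = suc (suc (suc (suc (suc (suc zero)))))
pattern p7 = suc (suc (suc (suc (suc (suc (suc zero))))))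

InI : Pt → Set
InI i = ¬ (i ≡ p0)

-- Fano plane lines: {1,2,5},{5,6,7},{1,4,7},{1,3,6},{2,4,6},{2,3,7},{3,4,5}.
-- For distinct i,j ∈ I, i * j is the third point of the line through i and j;
-- 0 * i = i * 0 = i and i * i = 0.  Full table:
infixl 7 _*_
_*_ : Pt → Pt → Pt
p0 * p0 = p0
p0 * p1 = p1
p0 * p2 = p2
p0 * p3 = p3
p0 * p4 = p4
p0 * p5 = p5
p0 * p6 = p6
p0 * p7 = p7
p1 * p0 = p1
p1 * p1 = p0
p1 * p2 = p5
p1 * p3 = p6
p1 * p4 = p7
p1 * p5 = p2
p1 * p6 = p3
p1 * p7 = p4
p2 * p0 = p2
p2 * p1 = p5
p2 * p2 = p0
p2 * p3 = p7
p2 * p4 = p6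
p2 * p5 = p1
p2 * p6 = p4
p2 * p7 = p3
p3 * p0 = p3
p3 * p1 = p6
p3 * p2 = p7
p3 * p3 = p0
p3 * p4 = p5
p3 * p5 = p4
p3 * p6 = p1
p3 * p7 = p2
p4 * p0 = p4
p4 * p1 = p7
p4 * p2 = p6
p4 * p3 = p5
p4 * p4 = p0
p4 * p5 = p3
p4 * p6 = p2
p4 * p7 = p1
p5 * p0 = p5
p5 * p1 = p2
p5 * p2 = p1
p5 * p3 = p4
p5 * p4 = p3
p5 * p5 = p0
p5 * p6 = p7
p5 * p7 = p6
p6 * p0 = p6
p6 * p1 = p3
p6 * p2 = p4
p6 * p3 = p1
p6 * p4 = p2
p6 * p5 = p7
p6 * p6 = p0
p6 * p7 = p5
p7 * p0 = p7
p7 * p1 = p4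
p7 * p2 = p3
p7 * p3 = p2
p7 * p4 = p1
p7 * p5 = p6
p7 * p6 = p5
p7 * p7 = p0

Generative : Pt → Pt → Pt → Set
Generative i j k =
  InI i × InI j × InI k × ¬ (i ≡ j) × ¬ (j ≡ k) × ¬ (i ≡ k) × ¬ (k ≡ i * j)

-- Unordered pairs {i,j} with i,j ∈ I₀ (i = j allowed): elements of X₀.
-- Represented canonically as (a , b) with toℕ a ≤ toℕ b.
record UPair : Set where
  constructor ⟨_,_∣_⟩
  field
    fst : Pt
    snd : Pt
    ord : toℕ fst Data.Nat.≤ toℕ snd

pair : Pt → Pt → UPair
pair i j with toℕ i Data.Nat.≤? toℕ j
... | Relation.Nullary.yes p = ⟨ i , j ∣ p ⟩
... | Relation.Nullary.no ¬p = ⟨ j , i ∣ Data.Nat.Properties.<⇒≤ (Data.Nat.Properties.≰⇒> ¬p) ⟩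

Subset : Set₁
Subset = Pred UPair 0ℓ

X : Subset
X p = InI (UPair.fst p) × InI (UPair.snd p) × ¬ (UPair.fst p ≡ UPair.snd p)

P⊆ : Pt → Pt → Pt → Subset → Set
P⊆ i j k T =
  T (pair i j) × T (pair j k) × T (pair k i) ×
  T (pair i (j * k)) × T (pair j (k * i)) × T (pair k (i * j))

GenNice : Subset → Set
GenNice T = ∀ (i j k : Pt) → T (pair i j) → T (pair (i * j) k) → P⊆ i j k T

Nice : Subset → Set
Nice T = (T ⊆ X) ×
  (∀ (i j k : Pt) → Generative i j k → T (pair i j) → T (pair (i * j) k) → P⊆ i j k T)

{-# OPTIONS --safe #-}
module Submission where

open import Defs
open import Data.Product using (_×_; _,_; proj₁; proj₂)
open import Data.Sum using (inj₁; inj₂)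
open import Data.Empty using (⊥-elim)
open import Data.Fin using (toℕ)
open import Data.Fin.Properties using (all?; _≟_)
open import Data.Nat using (_≤?_)
open import Relation.Nullary using (¬_; yes; no)
open import Relation.Nullary.Decidable using (from-yes)
open import Relation.Binary.Core using (Rel)
open import Relation.Binary.Definitions using (Symmetric)
open import Function using (_∘′_)
open import Relation.Binary.PropositionalEquality
  using (_≡_; _≢_; refl; sym; cong; subst; module ≡-Reasoning)
open import Relation.Unary using (_⊆_; _∩_; _∪_; ｛_｝)

-- (I₀, *) is the elementary abelian group of order 8, the Fano plane being the
-- projective plane over 𝔽₂; only commutativity, the unit and i * (i * j) = j are
-- needed.  Parts (ii) and (iii) are the closure condition for the triples
-- (i, 0, 0) and (i, i * j, i * j).  For (i), generativity of (i, j, k) makes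
-- every pair of P_{i,j,k} consist of distinct points of I.  For (iv), a pair of
-- T ⊆ X never contains 0 nor has i * j = 0, so {0,0} can only enter the closure
-- condition through the triple (0, 0, 0).

*-comm : ∀ i j → i * j ≡ j * i
*-comm = from-yes (all? λ i → all? λ j → i * j ≟ j * i)

*-identityʳ : ∀ i → i * p0 ≡ i
*-identityʳ = from-yes (all? λ i → i * p0 ≟ i)

*-involutive : ∀ i j → i * (i * j) ≡ j
*-involutive = from-yes (all? λ i → all? λ j → i * (i * j) ≟ j)

*≡p0⇒≡ : ∀ {i j} → i * j ≡ p0 → i ≡ j
*≡p0⇒≡ {i} {j} e = begin
  i             ≡⟨ sym (*-identityʳ i) ⟩
  i * p0        ≡⟨ cong (i *_) e ⟨
  i * (i * j)   ≡⟨ *-involutive i j ⟩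
  j             ∎
  where open ≡-Reasoning

≢⇒*-InI : ∀ {i j} → i ≢ j → InI (i * j)
≢⇒*-InI i≢j = i≢j ∘′ *≡p0⇒≡

*-rotate : ∀ {i j k} → i ≡ j * k → k ≡ i * j
*-rotate {j = j} {k} refl = sym (begin
  (j * k) * j   ≡⟨ *-comm (j * k) j ⟩
  j * (j * k)   ≡⟨ *-involutive j k ⟩
  k             ∎)
  where open ≡-Reasoning

Holds : ∀ {ℓ} → Rel Pt ℓ → UPair → Set ℓ
Holds R p = R (UPair.fst p) (UPair.snd p)

module _ {ℓ} (R : Rel Pt ℓ) (R-sym : Symmetric R) where

  pair⁺ : ∀ {a b} → R a b → Holds R (pair a b)
  pair⁺ {a} {b} r with toℕ a ≤? toℕ b
  ... | yes _ = r
  ... | no  _ = R-sym r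

  pair⁻ : ∀ {a b} → Holds R (pair a b) → R a b
  pair⁻ {a} {b} r with toℕ a ≤? toℕ b
  ... | yes _ = r
  ... | no  _ = R-sym r

Distinct : Rel Pt _
Distinct a b = InI a × InI b × a ≢ b

Distinct-sym : Symmetric Distinct
Distinct-sym (a , b , a≢b) = b , a , a≢b ∘′ sym

X-pair : ∀ {a b} → Distinct a b → X (pair a b)
X-pair = pair⁺ Distinct Distinct-sym

X-pair⁻ : ∀ {a b} → X (pair a b) → Distinct a b
X-pair⁻ = pair⁻ Distinct Distinct-sym

BothZero : Rel Pt _
BothZero a b = a ≡ p0 × b ≡ p0

BothZero-sym : Symmetric BothZero
BothZero-sym (a≡0 , b≡0) = b≡0 , a≡0

pair-p0p0-injective : ∀ {a b} → pair p0 p0 ≡ pair a b → BothZero a b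
pair-p0p0-injective e =
  pair⁻ BothZero BothZero-sym (subst (Holds BothZero) e (refl , refl))

GenNice⇒Nice-∩X : (T : Subset) → GenNice T → Nice (T ∩ X)
GenNice⇒Nice-∩X T nice = proj₂ , closed
  where
  closed : ∀ i j k → Generative i j k → (T ∩ X) (pair i j) → (T ∩ X) (pair (i * j) k) →
           P⊆ i j k (T ∩ X)
  closed i j k (i∈I , j∈I , k∈I , i≢j , j≢k , i≢k , k≢i*j) (ij∈T , _) (i*jk∈T , _)
    with nice i j k ij∈T i*jk∈T
  ... | ij , jk , ki , i[jk] , j[ki] , k[ij] =
    (ij , X-pair (i∈I , j∈I , i≢j)) ,
    (jk , X-pair (j∈I , k∈I , j≢k)) ,
    (ki , X-pair (k∈I , i∈I , i≢k ∘′ sym)) ,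
    (i[jk] , X-pair (i∈I , ≢⇒*-InI j≢k , k≢i*j ∘′ *-rotate)) ,
    (j[ki] , X-pair (j∈I , ≢⇒*-InI (i≢k ∘′ sym) , k≢i*j ∘′ *-rotate ∘′ *-rotate)) ,
    (k[ij] , X-pair (k∈I , ≢⇒*-InI i≢j , k≢i*j))

GenNice-p0 : (T : Subset) → GenNice T → ∀ i → T (pair i p0) → T (pair p0 p0)
GenNice-p0 T nice i i0∈T =
  proj₁ (proj₂ (nice i p0 p0 i0∈T (subst (λ x → T (pair x p0)) (sym (*-identityʳ i)) i0∈T)))

GenNice-diagonal : (T : Subset) → GenNice T → ∀ i j →
                   T (pair i (i * j)) → T (pair j (i * j)) → T (pair (i * j) (i * j))
GenNice-diagonal T nice i j ik∈T jk∈T =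
  proj₁ (proj₂ (nice i (i * j) (i * j) ik∈T
    (subst (λ x → T (pair x (i * j))) (sym (*-involutive i j)) jk∈T)))

GenNice-∪-p0p0 : (T : Subset) → GenNice T → T ⊆ X → GenNice (T ∪ ｛ pair p0 p0 ｝)
GenNice-∪-p0p0 _ nice T⊆X i j k (inj₁ ij∈T) (inj₁ i*jk∈T)
  with nice i j k ij∈T i*jk∈T
... | ij , jk , ki , i[jk] , j[ki] , k[ij] =
  inj₁ ij , inj₁ jk , inj₁ ki , inj₁ i[jk] , inj₁ j[ki] , inj₁ k[ij]
GenNice-∪-p0p0 _ _ T⊆X i j k (inj₁ ij∈T) (inj₂ e) =
  ⊥-elim (proj₂ (proj₂ (X-pair⁻ (T⊆X ij∈T))) (*≡p0⇒≡ (proj₁ (pair-p0p0-injective e))))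
GenNice-∪-p0p0 _ _ T⊆X i j k (inj₂ e) _
  with pair-p0p0-injective {i} {j} e
GenNice-∪-p0p0 _ _ T⊆X _ _ k (inj₂ _) (inj₁ 0k∈T) | refl , refl =
  ⊥-elim (proj₁ (X-pair⁻ (T⊆X 0k∈T)) refl)
GenNice-∪-p0p0 _ _ _ _ _ k (inj₂ _) (inj₂ e) | refl , refl
  with pair-p0p0-injective {p0} {k} e
... | _ , refl = inj₂ refl , inj₂ refl , inj₂ refl , inj₂ refl , inj₂ refl , inj₂ refl

lemma2p6 : (T : Subset) → GenNice T → (i j : Pt) → InI i → InI j → ¬ (i ≡ j) →
    Nice (T ∩ X)
    × (T (pair i p0) → T (pair p0 p0))
    × (T (pair i (i * j)) → T (pair j (i * j)) → T (pair (i * j) (i * j)))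
    × (T ⊆ X → GenNice (T ∪ ｛ pair p0 p0 ｝))
lemma2p6 T nice i j _ _ _ =
  GenNice⇒Nice-∩X T nice ,
  GenNice-p0 T nice i ,
  GenNice-diagonal T nice i j ,
  GenNice-∪-p0p0 T nice
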